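{- Let $\varphi,\psi,\chi,\theta$ be patterns such that $\varphi$ is a subpattern of $\chi$ and $\theta$ is obtained from $\chi$ by replacing one or more occurrences of $\varphi$ with $\psi$. Let $x_1,\ldots,x_n$ be element variables such that $(FV(\varphi)\cup FV(\psi))\cap BV(\chi)\subseteq\{x_1,\ldots,x_n\}$. Then $\vdash_{\mathcal{MG}^c}\forall x_1\ldots\forall x_n(\varphi=\psi)\to(\chi\leftrightarrow\theta)$.
   Context: Fix a countably infinite set $EVar$ of element variables and a set $\Sigma$ of constant symbols containing a distinguished "definedness symbol" $\lceil\,\rceil$. Patterns: $\varphi::= x\mid \sigma\mid \bot\mid \neg\varphi\mid \varphi\to\varphi\mid \varphi\wedge\varphi\mid\varphi\vee\varphi\mid \varphi\cdot\varphi\mid \forall x\varphi\mid\exists x\varphi$ ($\varphi\cdot\psi$ is application). Abbreviations: $\varphi\leftrightarrow\psi:=(\varphi\to\psi)\wedge(\psi\to\varphi)$, $\lceil\varphi\rceil:=\lceil\,\rceil\cdot\varphi$, $\lfloor\varphi\rfloor:=\neg\lceil\neg\varphi\rceil$, $\varphi=\psi:=\lfloor\varphi\leftrightarrow\psi\rfloor$. An occurrence of $x$ is bound if inside a subpattern $\forall x\eta$ or $\exists x\eta$, otherwise free; $FV(\varphi)$ is the set of variables with a free occurrence in $\varphi$ and $BV(\varphi)$ the set of variables with a bound occurrence in $\varphi$. $\vdash\psi$ means there is a finite sequence ending in $\psi$ of axiom instances or consequences of earlier members by rules. Proof system $\mathcal{MG}^c$. Axioms: $\varphi\vee\varphi\to\varphi$;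 $\varphi\to\varphi\wedge\varphi$; $\varphi\to\varphi\vee\psi$; $\varphi\wedge\psi\to\varphi$; $\varphi\vee\psi\to\psi\vee\varphi$; $\varphi\wedge\psi\to\psi\wedge\varphi$; $\bot\to\varphi$; $\varphi\vee\neg\varphi$; $\neg\varphi\to(\varphi\to\bot)$; $(\varphi\to\bot)\to\neg\varphi$; $\forall x(\varphi\to\psi)\to(\forall x\varphi\to\forall x\psi)$; $\varphi\to\forall x\varphi$ if $x$ does not occur in $\varphi$; $\exists x(x=y)$ for $y$ distinct from $x$; $\exists x\varphi\to\neg\forall x\neg\varphi$; $\neg\forall x\neg\varphi\to\exists x\varphi$; $(\varphi\vee\psi)\cdot\chi\to\varphi\cdot\chi\vee\psi\cdot\chi$; $\chi\cdot(\varphi\vee\psi)\to\chi\cdot\varphi\vee\chi\cdot\psi$; $(\exists x\varphi)\cdot\psi\to\exists x(\varphi\cdot\psi)$ and $\psi\cdot(\exists x\varphi)\to\exists x(\psi\cdot\varphi)$ if $x$ does not occur in $\psi$; $\lceil\varphi\rceil\cdot\psi\to\lceil\varphi\rceil$; $\psi\cdot\lceil\varphi\rceil\to\lceil\varphi\rceil$; $\lceil x\rceil$; $\varphi\to\lceil\varphi\rceil$; $\lceil\bot\rceil\to\bot$. Rules: from $\varphi$, $\varphi\to\psi$ infer $\psi$; from $\varphi\to\psi$, $\psi\to\chi$ infer $\varphi\to\chi$; from $\varphi\wedge\psi\to\chi$ infer $\varphi\to(\psi\to\chi)$; from $\varphi\to(\psi\to\chi)$ infer $\varphi\wedge\psi\to\chi$;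 from $\varphi\to\psi$ infer $\chi\vee\varphi\to\chi\vee\psi$; from $\varphi$ infer $\forall x\varphi$; from $\varphi\to\psi$ infer $\varphi\cdot\chi\to\psi\cdot\chi$ and $\chi\cdot\varphi\to\chi\cdot\psi$. -}

module Defs where

open import Data.Nat using (ℕ)
open import Data.Bool using (Bool; true; false; _∨_)
open import Data.List using (List; []; _∷_)
open import Data.Empty using (⊥)
open import Relation.Nullary using (¬_)
open import Relation.Binary.PropositionalEquality using (_≡_; _≢_)

EVar : Set
EVar = ℕ

infixr 5 _⇒_
infixr 6 _∨ᵖ_
infixr 7 _∧ᵖ_
infixl 8 _·_
data Pattern (Sym : Set) : Set where
  var  : EVar → Pattern Sym
  sym  : Sym → Pattern Sym
  ⊥ᵖ   : Pattern Sym
  ¬ᵖ_  : Pattern Sym → Pattern Sym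
  _⇒_  : Pattern Sym → Pattern Sym → Pattern Sym
  _∧ᵖ_ : Pattern Sym → Pattern Sym → Pattern Sym
  _∨ᵖ_ : Pattern Sym → Pattern Sym → Pattern Sym
  _·_  : Pattern Sym → Pattern Sym → Pattern Sym
  ∀ᵖ   : EVar → Pattern Sym → Pattern Sym
  ∃ᵖ   : EVar → Pattern Sym → Pattern Sym

module _ {Sym : Set} where

  data _∈FV_ (x : EVar) : Pattern Sym → Set where
    fv-var  : x ∈FV var x
    fv-¬    : ∀ {φ} → x ∈FV φ → x ∈FV (¬ᵖ φ)
    fv-⇒ₗ   : ∀ {φ ψ} → x ∈FV φ → x ∈FV (φ ⇒ ψ)
    fv-⇒ᵣ   : ∀ {φ ψ} → x ∈FV ψ → x ∈FV (φ ⇒ ψ)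
    fv-∧ₗ   : ∀ {φ ψ} → x ∈FV φ → x ∈FV (φ ∧ᵖ ψ)
    fv-∧ᵣ   : ∀ {φ ψ} → x ∈FV ψ → x ∈FV (φ ∧ᵖ ψ)
    fv-∨ₗ   : ∀ {φ ψ} → x ∈FV φ → x ∈FV (φ ∨ᵖ ψ)
    fv-∨ᵣ   : ∀ {φ ψ} → x ∈FV ψ → x ∈FV (φ ∨ᵖ ψ)
    fv-·ₗ   : ∀ {φ ψ} → x ∈FV φ → x ∈FV (φ · ψ)
    fv-·ᵣ   : ∀ {φ ψ} → x ∈FV ψ → x ∈FV (φ · ψ)
    fv-∀    : ∀ {y φ} → x ≢ y → x ∈FV φ → x ∈FV (∀ᵖ y φ)
    fv-∃    : ∀ {y φ} → x ≢ y → x ∈FV φ → x ∈FV (∃ᵖ y φ)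

  -- x has a bound occurrence in φ (the binder occurrence in ∀x/∃x counts)
  data _∈BV_ (x : EVar) : Pattern Sym → Set where
    bv-¬    : ∀ {φ} → x ∈BV φ → x ∈BV (¬ᵖ φ)
    bv-⇒ₗ   : ∀ {φ ψ} → x ∈BV φ → x ∈BV (φ ⇒ ψ)
    bv-⇒ᵣ   : ∀ {φ ψ} → x ∈BV ψ → x ∈BV (φ ⇒ ψ)
    bv-∧ₗ   : ∀ {φ ψ} → x ∈BV φ → x ∈BV (φ ∧ᵖ ψ)
    bv-∧ᵣ   : ∀ {φ ψ} → x ∈BV ψ → x ∈BV (φ ∧ᵖ ψ)
    bv-∨ₗ   : ∀ {φ ψ} → x ∈BV φ → x ∈BV (φ ∨ᵖ ψ)
    bv-∨ᵣ   : ∀ {φ ψ} → x ∈BV ψ → x ∈BV (φ ∨ᵖ ψ)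
    bv-·ₗ   : ∀ {φ ψ} → x ∈BV φ → x ∈BV (φ · ψ)
    bv-·ᵣ   : ∀ {φ ψ} → x ∈BV ψ → x ∈BV (φ · ψ)
    bv-∀    : ∀ {φ} → x ∈BV (∀ᵖ x φ)
    bv-∃    : ∀ {φ} → x ∈BV (∃ᵖ x φ)
    bv-∀ᵢ   : ∀ {y φ} → x ∈BV φ → x ∈BV (∀ᵖ y φ)
    bv-∃ᵢ   : ∀ {y φ} → x ∈BV φ → x ∈BV (∃ᵖ y φ)

  NotOccurs : EVar → Pattern Sym → Set
  NotOccurs x φ = (¬ (x ∈FV φ)) Data.Product.× (¬ (x ∈BV φ))
    where import Data.Product

  -- Replace φ by ψ: Replace φ ψ b χ θ means θ is obtained from χ by
  -- replacing some occurrences of φ by ψ; b = true iff at least one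
  -- occurrence was replaced.
  data Replace (φ ψ : Pattern Sym) : Bool → Pattern Sym → Pattern Sym → Set where
    here : Replace φ ψ true φ ψ
    r-var : ∀ {x} → Replace φ ψ false (var x) (var x)
    r-sym : ∀ {s} → Replace φ ψ false (sym s) (sym s)
    r-⊥   : Replace φ ψ false ⊥ᵖ ⊥ᵖ
    r-¬   : ∀ {b χ θ} → Replace φ ψ b χ θ → Replace φ ψ b (¬ᵖ χ) (¬ᵖ θ)
    r-⇒   : ∀ {b₁ b₂ χ₁ θ₁ χ₂ θ₂} → Replace φ ψ b₁ χ₁ θ₁ → Replace φ ψ b₂ χ₂ θ₂
          → Replace φ ψ (b₁ ∨ b₂) (χ₁ ⇒ χ₂) (θ₁ ⇒ θ₂)
    r-∧   : ∀ {b₁ b₂ χ₁ θ₁ χ₂ θ₂} → Replace φ ψ b₁ χ₁ θ₁ → Replace φ ψ b₂ χ₂ θ₂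
          → Replace φ ψ (b₁ ∨ b₂) (χ₁ ∧ᵖ χ₂) (θ₁ ∧ᵖ θ₂)
    r-∨   : ∀ {b₁ b₂ χ₁ θ₁ χ₂ θ₂} → Replace φ ψ b₁ χ₁ θ₁ → Replace φ ψ b₂ χ₂ θ₂
          → Replace φ ψ (b₁ ∨ b₂) (χ₁ ∨ᵖ χ₂) (θ₁ ∨ᵖ θ₂)
    r-·   : ∀ {b₁ b₂ χ₁ θ₁ χ₂ θ₂} → Replace φ ψ b₁ χ₁ θ₁ → Replace φ ψ b₂ χ₂ θ₂
          → Replace φ ψ (b₁ ∨ b₂) (χ₁ · χ₂) (θ₁ · θ₂)
    r-∀   : ∀ {b x χ θ} → Replace φ ψ b χ θ → Replace φ ψ b (∀ᵖ x χ) (∀ᵖ x θ)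
    r-∃   : ∀ {b x χ θ} → Replace φ ψ b χ θ → Replace φ ψ b (∃ᵖ x χ) (∃ᵖ x θ)

  data _⊑_ (φ : Pattern Sym) : Pattern Sym → Set where
    ⊑-refl : φ ⊑ φ
    ⊑-¬    : ∀ {χ} → φ ⊑ χ → φ ⊑ (¬ᵖ χ)
    ⊑-⇒ₗ   : ∀ {χ η} → φ ⊑ χ → φ ⊑ (χ ⇒ η)
    ⊑-⇒ᵣ   : ∀ {χ η} → φ ⊑ η → φ ⊑ (χ ⇒ η)
    ⊑-∧ₗ   : ∀ {χ η} → φ ⊑ χ → φ ⊑ (χ ∧ᵖ η)
    ⊑-∧ᵣ   : ∀ {χ η} → φ ⊑ η → φ ⊑ (χ ∧ᵖ η)
    ⊑-∨ₗ   : ∀ {χ η} → φ ⊑ χ → φ ⊑ (χ ∨ᵖ η)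
    ⊑-∨ᵣ   : ∀ {χ η} → φ ⊑ η → φ ⊑ (χ ∨ᵖ η)
    ⊑-·ₗ   : ∀ {χ η} → φ ⊑ χ → φ ⊑ (χ · η)
    ⊑-·ᵣ   : ∀ {χ η} → φ ⊑ η → φ ⊑ (χ · η)
    ⊑-∀    : ∀ {x χ} → φ ⊑ χ → φ ⊑ (∀ᵖ x χ)
    ⊑-∃    : ∀ {x χ} → φ ⊑ χ → φ ⊑ (∃ᵖ x χ)

  _⇔_ : Pattern Sym → Pattern Sym → Pattern Sym
  φ ⇔ ψ = (φ ⇒ ψ) ∧ᵖ (ψ ⇒ φ)

  ∀* : List EVar → Pattern Sym → Pattern Sym
  ∀* []       φ = φ
  ∀* (x ∷ xs) φ = ∀ᵖ x (∀* xs φ)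

module Definedness {Sym : Set} (def : Sym) where

  ⌈_⌉ : Pattern Sym → Pattern Sym
  ⌈ φ ⌉ = sym def · φ

  ⌊_⌋ : Pattern Sym → Pattern Sym
  ⌊ φ ⌋ = ¬ᵖ ⌈ ¬ᵖ φ ⌉

  _=ᵖ_ : Pattern Sym → Pattern Sym → Pattern Sym
  φ =ᵖ ψ = ⌊ φ ⇔ ψ ⌋

  data ⊢_ : Pattern Sym → Set where
    ax-∨-idem  : ∀ φ → ⊢ (φ ∨ᵖ φ ⇒ φ)
    ax-∧-dup   : ∀ φ → ⊢ (φ ⇒ φ ∧ᵖ φ)
    ax-∨-intro : ∀ φ ψ → ⊢ (φ ⇒ φ ∨ᵖ ψ)
    ax-∧-elim  : ∀ φ ψ → ⊢ (φ ∧ᵖ ψ ⇒ φ)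
    ax-∨-comm  : ∀ φ ψ → ⊢ (φ ∨ᵖ ψ ⇒ ψ ∨ᵖ φ)
    ax-∧-comm  : ∀ φ ψ → ⊢ (φ ∧ᵖ ψ ⇒ ψ ∧ᵖ φ)
    ax-⊥       : ∀ φ → ⊢ (⊥ᵖ ⇒ φ)
    ax-lem     : ∀ φ → ⊢ (φ ∨ᵖ ¬ᵖ φ)
    ax-¬-⇒     : ∀ φ → ⊢ (¬ᵖ φ ⇒ (φ ⇒ ⊥ᵖ))
    ax-⇒-¬     : ∀ φ → ⊢ ((φ ⇒ ⊥ᵖ) ⇒ ¬ᵖ φ)
    ax-∀-dist  : ∀ x φ ψ → ⊢ (∀ᵖ x (φ ⇒ ψ) ⇒ (∀ᵖ x φ ⇒ ∀ᵖ x ψ))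
    ax-∀-vac   : ∀ x φ → NotOccurs x φ → ⊢ (φ ⇒ ∀ᵖ x φ)
    ax-exists  : ∀ x y → x ≢ y → ⊢ (∃ᵖ x (var x =ᵖ var y))
    ax-∃-∀     : ∀ x φ → ⊢ (∃ᵖ x φ ⇒ ¬ᵖ ∀ᵖ x (¬ᵖ φ))
    ax-∀-∃     : ∀ x φ → ⊢ (¬ᵖ ∀ᵖ x (¬ᵖ φ) ⇒ ∃ᵖ x φ)
    ax-prop-∨ₗ : ∀ φ ψ χ → ⊢ ((φ ∨ᵖ ψ) · χ ⇒ φ · χ ∨ᵖ ψ · χ)
    ax-prop-∨ᵣ : ∀ φ ψ χ → ⊢ (χ · (φ ∨ᵖ ψ) ⇒ χ · φ ∨ᵖ χ · ψ)
    ax-prop-∃ₗ : ∀ x φ ψ → NotOccurs x ψ → ⊢ ((∃ᵖ x φ) · ψ ⇒ ∃ᵖ x (φ · ψ))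
    ax-prop-∃ᵣ : ∀ x φ ψ → NotOccurs x ψ → ⊢ (ψ · (∃ᵖ x φ) ⇒ ∃ᵖ x (ψ · φ))
    ax-def-·ₗ  : ∀ φ ψ → ⊢ (⌈ φ ⌉ · ψ ⇒ ⌈ φ ⌉)
    ax-def-·ᵣ  : ∀ φ ψ → ⊢ (ψ · ⌈ φ ⌉ ⇒ ⌈ φ ⌉)
    ax-def-var : ∀ x → ⊢ ⌈ var x ⌉
    ax-def-in  : ∀ φ → ⊢ (φ ⇒ ⌈ φ ⌉)
    ax-def-⊥   : ⊢ (⌈ ⊥ᵖ ⌉ ⇒ ⊥ᵖ)
    r-mp       : ∀ {φ ψ} → ⊢ φ → ⊢ (φ ⇒ ψ) → ⊢ ψ
    r-syll     : ∀ {φ ψ χ} → ⊢ (φ ⇒ ψ) → ⊢ (ψ ⇒ χ) → ⊢ (φ ⇒ χ)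
    r-exp      : ∀ {φ ψ χ} → ⊢ (φ ∧ᵖ ψ ⇒ χ) → ⊢ (φ ⇒ (ψ ⇒ χ))
    r-imp      : ∀ {φ ψ χ} → ⊢ (φ ⇒ (ψ ⇒ χ)) → ⊢ (φ ∧ᵖ ψ ⇒ χ)
    r-∨-mono   : ∀ {φ ψ} χ → ⊢ (φ ⇒ ψ) → ⊢ (χ ∨ᵖ φ ⇒ χ ∨ᵖ ψ)
    r-gen      : ∀ {φ} x → ⊢ φ → ⊢ (∀ᵖ x φ)
    r-frameₗ   : ∀ {φ ψ} χ → ⊢ (φ ⇒ ψ) → ⊢ (φ · χ ⇒ ψ · χ)
    r-frameᵣ   : ∀ {φ ψ} χ → ⊢ (φ ⇒ ψ) → ⊢ (χ · φ ⇒ χ · ψ)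

-- The replacement is proved by induction on χ under an arbitrary hypothesis H with three
-- properties: H entails φ ⇔ ψ; H entails ∀z H for every bound variable z of χ, which is
-- what carries the induction under binders; and H is a predicate, ⌈¬H⌉ → ¬H, which is
-- what carries it through the framing rules at applications.  For H = ∀xs (φ = ψ) the
-- first needs ∀-instantiation and the second needs A → ∀y A for y merely not free in A;
-- MG^c has neither (its axiom A → ∀y A asks y not to occur in A at all).  Both are
-- obtained by α-renaming binders to fresh variables.  That renaming is itself an instance
-- of the same replacement argument, now under the hypothesis x = w, and instantiation
-- picks the x equal to a fresh w by the axiom ∃x (x = w).
module Submission where

open import Data.Bool using (true; false)
open import Data.Empty using (⊥-elim)
open import Data.List using (List; []; _∷_)
open import Data.List.Membership.Propositional using (_∈_; _∉_)
open import Data.List.Relation.Unary.Any using (here; there)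
open import Data.Nat using (suc; _⊔_; _≤_; s≤s; _≟_)
open import Data.Nat.Properties using (≤-refl; m≤m⊔n; m≤n⊔m; m≤n⇒m≤n⊔o; m≤n⇒m≤o⊔n; n≮n; <⇒≢)
open import Data.Product using (∃-syntax; _×_; _,_; proj₂; map₂; zip)
open import Data.Sum using (_⊎_; inj₁; inj₂; [_,_]′)
open import Function using (_∘_)
open import Relation.Nullary using (¬_; yes; no)
open import Relation.Binary.PropositionalEquality using (_≢_; refl; ≢-sym)

open import Defs

module _ {Sym : Set} where

  private
    variable
      x y z w : EVar
      A B C A′ B′ H X Y : Pattern Sym

  -- Variables: occurrence, freshness, renaming

  notOccurs-var : z ≢ x → NotOccurs z (var {Sym} x)
  notOccurs-var z≢x = (λ { fv-var → z≢x refl }) , λ ()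

  notOccurs-¬ : NotOccurs z A → NotOccurs z (¬ᵖ A)
  notOccurs-¬ (z∉FV , z∉BV) = (λ { (fv-¬ p) → z∉FV p }) , λ { (bv-¬ p) → z∉BV p }

  ∉BV-∀ : z ≢ x → ¬ z ∈BV A → ¬ z ∈BV ∀ᵖ x A
  ∉BV-∀ z≢x z∉BV bv-∀        = z≢x refl
  ∉BV-∀ z≢x z∉BV (bv-∀ᵢ p)   = z∉BV p

  ∉BV-∃ : z ≢ x → ¬ z ∈BV A → ¬ z ∈BV ∃ᵖ x A
  ∉BV-∃ z≢x z∉BV bv-∃        = z≢x refl
  ∉BV-∃ z≢x z∉BV (bv-∃ᵢ p)   = z∉BV p

  notOccurs-∀ : z ≢ x → NotOccurs z A → NotOccurs z (∀ᵖ x A)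
  notOccurs-∀ z≢x (z∉FV , z∉BV) = (λ { (fv-∀ _ p) → z∉FV p }) , ∉BV-∀ z≢x z∉BV

  ∈FV-∀* : ∀ xs → z ∈FV ∀* xs A → z ∈FV A × z ∉ xs
  ∈FV-∀* []       p            = p , λ ()
  ∈FV-∀* (x ∷ xs) (fv-∀ z≢x p) with ∈FV-∀* xs p
  ... | z∈FV , z∉xs = z∈FV , λ { (here z≡x) → z≢x z≡x ; (there z∈xs) → z∉xs z∈xs }

  maxVar : Pattern Sym → EVar
  maxVar (var x)    = x
  maxVar (sym _)    = 0
  maxVar ⊥ᵖ         = 0
  maxVar (¬ᵖ A)     = maxVar A
  maxVar (A ⇒ B)    = maxVar A ⊔ maxVar B
  maxVar (A ∧ᵖ B)   = maxVar A ⊔ maxVar B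
  maxVar (A ∨ᵖ B)   = maxVar A ⊔ maxVar B
  maxVar (A · B)    = maxVar A ⊔ maxVar B
  maxVar (∀ᵖ x A)   = x ⊔ maxVar A
  maxVar (∃ᵖ x A)   = x ⊔ maxVar A

  ∈FV⇒≤maxVar : z ∈FV A → z ≤ maxVar A
  ∈FV⇒≤maxVar               fv-var     = ≤-refl
  ∈FV⇒≤maxVar               (fv-¬ p)   = ∈FV⇒≤maxVar p
  ∈FV⇒≤maxVar {A = _ ⇒ B}   (fv-⇒ₗ p)  = m≤n⇒m≤n⊔o (maxVar B) (∈FV⇒≤maxVar p)
  ∈FV⇒≤maxVar {A = A ⇒ _}   (fv-⇒ᵣ p)  = m≤n⇒m≤o⊔n (maxVar A) (∈FV⇒≤maxVar p)
  ∈FV⇒≤maxVar {A = _ ∧ᵖ B}  (fv-∧ₗ p)  = m≤n⇒m≤n⊔o (maxVar B) (∈FV⇒≤maxVar p)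
  ∈FV⇒≤maxVar {A = A ∧ᵖ _}  (fv-∧ᵣ p)  = m≤n⇒m≤o⊔n (maxVar A) (∈FV⇒≤maxVar p)
  ∈FV⇒≤maxVar {A = _ ∨ᵖ B}  (fv-∨ₗ p)  = m≤n⇒m≤n⊔o (maxVar B) (∈FV⇒≤maxVar p)
  ∈FV⇒≤maxVar {A = A ∨ᵖ _}  (fv-∨ᵣ p)  = m≤n⇒m≤o⊔n (maxVar A) (∈FV⇒≤maxVar p)
  ∈FV⇒≤maxVar {A = _ · B}   (fv-·ₗ p)  = m≤n⇒m≤n⊔o (maxVar B) (∈FV⇒≤maxVar p)
  ∈FV⇒≤maxVar {A = A · _}   (fv-·ᵣ p)  = m≤n⇒m≤o⊔n (maxVar A) (∈FV⇒≤maxVar p)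
  ∈FV⇒≤maxVar {A = ∀ᵖ x _}  (fv-∀ _ p) = m≤n⇒m≤o⊔n x (∈FV⇒≤maxVar p)
  ∈FV⇒≤maxVar {A = ∃ᵖ x _}  (fv-∃ _ p) = m≤n⇒m≤o⊔n x (∈FV⇒≤maxVar p)

  ∈BV⇒≤maxVar : z ∈BV A → z ≤ maxVar A
  ∈BV⇒≤maxVar               (bv-¬ p)   = ∈BV⇒≤maxVar p
  ∈BV⇒≤maxVar {A = _ ⇒ B}   (bv-⇒ₗ p)  = m≤n⇒m≤n⊔o (maxVar B) (∈BV⇒≤maxVar p)
  ∈BV⇒≤maxVar {A = A ⇒ _}   (bv-⇒ᵣ p)  = m≤n⇒m≤o⊔n (maxVar A) (∈BV⇒≤maxVar p)
  ∈BV⇒≤maxVar {A = _ ∧ᵖ B}  (bv-∧ₗ p)  = m≤n⇒m≤n⊔o (maxVar B) (∈BV⇒≤maxVar p)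
  ∈BV⇒≤maxVar {A = A ∧ᵖ _}  (bv-∧ᵣ p)  = m≤n⇒m≤o⊔n (maxVar A) (∈BV⇒≤maxVar p)
  ∈BV⇒≤maxVar {A = _ ∨ᵖ B}  (bv-∨ₗ p)  = m≤n⇒m≤n⊔o (maxVar B) (∈BV⇒≤maxVar p)
  ∈BV⇒≤maxVar {A = A ∨ᵖ _}  (bv-∨ᵣ p)  = m≤n⇒m≤o⊔n (maxVar A) (∈BV⇒≤maxVar p)
  ∈BV⇒≤maxVar {A = _ · B}   (bv-·ₗ p)  = m≤n⇒m≤n⊔o (maxVar B) (∈BV⇒≤maxVar p)
  ∈BV⇒≤maxVar {A = A · _}   (bv-·ᵣ p)  = m≤n⇒m≤o⊔n (maxVar A) (∈BV⇒≤maxVar p)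
  ∈BV⇒≤maxVar {A = ∀ᵖ x A}  bv-∀       = m≤m⊔n x (maxVar A)
  ∈BV⇒≤maxVar {A = ∀ᵖ x _}  (bv-∀ᵢ p)  = m≤n⇒m≤o⊔n x (∈BV⇒≤maxVar p)
  ∈BV⇒≤maxVar {A = ∃ᵖ x A}  bv-∃       = m≤m⊔n x (maxVar A)
  ∈BV⇒≤maxVar {A = ∃ᵖ x _}  (bv-∃ᵢ p)  = m≤n⇒m≤o⊔n x (∈BV⇒≤maxVar p)

  freshVar : Pattern Sym → EVar → EVar
  freshVar A y = suc (maxVar A ⊔ y)

  freshVar-notOccurs : NotOccurs (freshVar A y) A
  freshVar-notOccurs {A = A} {y = y} = beyond ∘ ∈FV⇒≤maxVar , beyond ∘ ∈BV⇒≤maxVar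
    where
      beyond : ¬ freshVar A y ≤ maxVar A
      beyond p = n≮n _ (m≤n⇒m≤n⊔o y p)

  freshVar-≢ : ∀ A → y ≢ freshVar A y
  freshVar-≢ {y = y} A = <⇒≢ (s≤s (m≤n⊔m (maxVar A) y))

  renameVar : EVar → EVar → Pattern Sym → Pattern Sym
  renameVar x w (var z) with z ≟ x
  ... | yes _ = var w
  ... | no _  = var z
  renameVar x w (sym s)  = sym s
  renameVar x w ⊥ᵖ       = ⊥ᵖ
  renameVar x w (¬ᵖ A)   = ¬ᵖ renameVar x w A
  renameVar x w (A ⇒ B)  = renameVar x w A ⇒ renameVar x w B
  renameVar x w (A ∧ᵖ B) = renameVar x w A ∧ᵖ renameVar x w B
  renameVar x w (A ∨ᵖ B) = renameVar x w A ∨ᵖ renameVar x w B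
  renameVar x w (A · B)  = renameVar x w A · renameVar x w B
  renameVar x w (∀ᵖ z A) = ∀ᵖ z (renameVar x w A)
  renameVar x w (∃ᵖ z A) = ∃ᵖ z (renameVar x w A)

  renameVar-replace : ∀ x w A → ∃[ b ] Replace (var x) (var w) b A (renameVar x w A)
  renameVar-replace x w (var z) with z ≟ x
  ... | yes refl = true , here
  ... | no _     = false , r-var
  renameVar-replace x w (sym s)  = false , r-sym
  renameVar-replace x w ⊥ᵖ       = false , r-⊥
  renameVar-replace x w (¬ᵖ A)   = map₂ r-¬ (renameVar-replace x w A)
  renameVar-replace x w (A ⇒ B)  = zip _ r-⇒ (renameVar-replace x w A) (renameVar-replace x w B)
  renameVar-replace x w (A ∧ᵖ B) = zip _ r-∧ (renameVar-replace x w A) (renameVar-replace x w B)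
  renameVar-replace x w (A ∨ᵖ B) = zip _ r-∨ (renameVar-replace x w A) (renameVar-replace x w B)
  renameVar-replace x w (A · B)  = zip _ r-· (renameVar-replace x w A) (renameVar-replace x w B)
  renameVar-replace x w (∀ᵖ z A) = map₂ r-∀ (renameVar-replace x w A)
  renameVar-replace x w (∃ᵖ z A) = map₂ r-∃ (renameVar-replace x w A)

  renameVar-∈BV : ∀ A → z ∈BV renameVar x w A → z ∈BV A
  renameVar-∈BV {x = x} (var z) p with z ≟ x
  renameVar-∈BV (var z) () | yes _
  renameVar-∈BV (var z) () | no _
  renameVar-∈BV (¬ᵖ A)   (bv-¬ p)  = bv-¬ (renameVar-∈BV A p)
  renameVar-∈BV (A ⇒ _)  (bv-⇒ₗ p) = bv-⇒ₗ (renameVar-∈BV A p)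
  renameVar-∈BV (_ ⇒ B)  (bv-⇒ᵣ p) = bv-⇒ᵣ (renameVar-∈BV B p)
  renameVar-∈BV (A ∧ᵖ _) (bv-∧ₗ p) = bv-∧ₗ (renameVar-∈BV A p)
  renameVar-∈BV (_ ∧ᵖ B) (bv-∧ᵣ p) = bv-∧ᵣ (renameVar-∈BV B p)
  renameVar-∈BV (A ∨ᵖ _) (bv-∨ₗ p) = bv-∨ₗ (renameVar-∈BV A p)
  renameVar-∈BV (_ ∨ᵖ B) (bv-∨ᵣ p) = bv-∨ᵣ (renameVar-∈BV B p)
  renameVar-∈BV (A · _)  (bv-·ₗ p) = bv-·ₗ (renameVar-∈BV A p)
  renameVar-∈BV (_ · B)  (bv-·ᵣ p) = bv-·ᵣ (renameVar-∈BV B p)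
  renameVar-∈BV (∀ᵖ _ _) bv-∀      = bv-∀
  renameVar-∈BV (∀ᵖ _ A) (bv-∀ᵢ p) = bv-∀ᵢ (renameVar-∈BV A p)
  renameVar-∈BV (∃ᵖ _ _) bv-∃      = bv-∃
  renameVar-∈BV (∃ᵖ _ A) (bv-∃ᵢ p) = bv-∃ᵢ (renameVar-∈BV A p)

  renameVar-∉FV : ∀ A → x ≢ w → ¬ x ∈FV renameVar x w A
  renameVar-∉FV {x = x} (var z) x≢w p with z ≟ x
  renameVar-∉FV (var z) x≢w fv-var | yes _   = x≢w refl
  renameVar-∉FV (var z) x≢w fv-var | no z≢x  = z≢x refl
  renameVar-∉FV (¬ᵖ A)   x≢w (fv-¬ p)   = renameVar-∉FV A x≢w p
  renameVar-∉FV (A ⇒ _)  x≢w (fv-⇒ₗ p)  = renameVar-∉FV A x≢w p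
  renameVar-∉FV (_ ⇒ B)  x≢w (fv-⇒ᵣ p)  = renameVar-∉FV B x≢w p
  renameVar-∉FV (A ∧ᵖ _) x≢w (fv-∧ₗ p)  = renameVar-∉FV A x≢w p
  renameVar-∉FV (_ ∧ᵖ B) x≢w (fv-∧ᵣ p)  = renameVar-∉FV B x≢w p
  renameVar-∉FV (A ∨ᵖ _) x≢w (fv-∨ₗ p)  = renameVar-∉FV A x≢w p
  renameVar-∉FV (_ ∨ᵖ B) x≢w (fv-∨ᵣ p)  = renameVar-∉FV B x≢w p
  renameVar-∉FV (A · _)  x≢w (fv-·ₗ p)  = renameVar-∉FV A x≢w p
  renameVar-∉FV (_ · B)  x≢w (fv-·ᵣ p)  = renameVar-∉FV B x≢w p
  renameVar-∉FV (∀ᵖ _ A) x≢w (fv-∀ _ p) = renameVar-∉FV A x≢w p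
  renameVar-∉FV (∃ᵖ _ A) x≢w (fv-∃ _ p) = renameVar-∉FV A x≢w p

  renameVar-notOccurs : ¬ x ∈BV A → x ≢ w → NotOccurs x (renameVar x w A)
  renameVar-notOccurs {A = A} x∉BV x≢w = renameVar-∉FV A x≢w , x∉BV ∘ renameVar-∈BV A

  freshenBinders : EVar → Pattern Sym → Pattern Sym
  freshenBinders y (var x)    = var x
  freshenBinders y (sym s)    = sym s
  freshenBinders y ⊥ᵖ         = ⊥ᵖ
  freshenBinders y (¬ᵖ A)     = ¬ᵖ freshenBinders y A
  freshenBinders y (A ⇒ B)    = freshenBinders y A ⇒ freshenBinders y B
  freshenBinders y (A ∧ᵖ B)   = freshenBinders y A ∧ᵖ freshenBinders y B
  freshenBinders y (A ∨ᵖ B)   = freshenBinders y A ∨ᵖ freshenBinders y B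
  freshenBinders y (A · B)    = freshenBinders y A · freshenBinders y B
  freshenBinders y (∀ᵖ z A) with z ≟ y
  ... | yes _ = let B = freshenBinders y A in ∀ᵖ (freshVar B y) (renameVar y (freshVar B y) B)
  ... | no _  = ∀ᵖ z (freshenBinders y A)
  freshenBinders y (∃ᵖ z A) with z ≟ y
  ... | yes _ = let B = freshenBinders y A in ∃ᵖ (freshVar B y) (renameVar y (freshVar B y) B)
  ... | no _  = ∃ᵖ z (freshenBinders y A)

  freshenBinders-∉BV : ∀ A → ¬ y ∈BV freshenBinders y A
  freshenBinders-∉BV (¬ᵖ A)   (bv-¬ p)  = freshenBinders-∉BV A p
  freshenBinders-∉BV (A ⇒ _)  (bv-⇒ₗ p) = freshenBinders-∉BV A p
  freshenBinders-∉BV (_ ⇒ B)  (bv-⇒ᵣ p) = freshenBinders-∉BV B p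
  freshenBinders-∉BV (A ∧ᵖ _) (bv-∧ₗ p) = freshenBinders-∉BV A p
  freshenBinders-∉BV (_ ∧ᵖ B) (bv-∧ᵣ p) = freshenBinders-∉BV B p
  freshenBinders-∉BV (A ∨ᵖ _) (bv-∨ₗ p) = freshenBinders-∉BV A p
  freshenBinders-∉BV (_ ∨ᵖ B) (bv-∨ᵣ p) = freshenBinders-∉BV B p
  freshenBinders-∉BV (A · _)  (bv-·ₗ p) = freshenBinders-∉BV A p
  freshenBinders-∉BV (_ · B)  (bv-·ᵣ p) = freshenBinders-∉BV B p
  freshenBinders-∉BV {y = y} (∀ᵖ z A) with z ≟ y
  ... | yes _   =
    ∉BV-∀ (freshVar-≢ (freshenBinders y A)) (freshenBinders-∉BV A ∘ renameVar-∈BV (freshenBinders y A))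
  ... | no z≢y  = ∉BV-∀ (≢-sym z≢y) (freshenBinders-∉BV A)
  freshenBinders-∉BV {y = y} (∃ᵖ z A) with z ≟ y
  ... | yes _   =
    ∉BV-∃ (freshVar-≢ (freshenBinders y A)) (freshenBinders-∉BV A ∘ renameVar-∈BV (freshenBinders y A))
  ... | no z≢y  = ∉BV-∃ (≢-sym z≢y) (freshenBinders-∉BV A)

  freshenBinders-∈FV : ∀ A → y ∈FV freshenBinders y A → y ∈FV A
  freshenBinders-∈FV (var x)  p         = p
  freshenBinders-∈FV (¬ᵖ A)   (fv-¬ p)  = fv-¬ (freshenBinders-∈FV A p)
  freshenBinders-∈FV (A ⇒ _)  (fv-⇒ₗ p) = fv-⇒ₗ (freshenBinders-∈FV A p)
  freshenBinders-∈FV (_ ⇒ B)  (fv-⇒ᵣ p) = fv-⇒ᵣ (freshenBinders-∈FV B p)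
  freshenBinders-∈FV (A ∧ᵖ _) (fv-∧ₗ p) = fv-∧ₗ (freshenBinders-∈FV A p)
  freshenBinders-∈FV (_ ∧ᵖ B) (fv-∧ᵣ p) = fv-∧ᵣ (freshenBinders-∈FV B p)
  freshenBinders-∈FV (A ∨ᵖ _) (fv-∨ₗ p) = fv-∨ₗ (freshenBinders-∈FV A p)
  freshenBinders-∈FV (_ ∨ᵖ B) (fv-∨ᵣ p) = fv-∨ᵣ (freshenBinders-∈FV B p)
  freshenBinders-∈FV (A · _)  (fv-·ₗ p) = fv-·ₗ (freshenBinders-∈FV A p)
  freshenBinders-∈FV (_ · B)  (fv-·ᵣ p) = fv-·ᵣ (freshenBinders-∈FV B p)
  freshenBinders-∈FV {y = y} (∀ᵖ z A) p with z ≟ y | p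
  ... | yes _  | fv-∀ _ q   =
    ⊥-elim (renameVar-∉FV (freshenBinders y A) (freshVar-≢ (freshenBinders y A)) q)
  ... | no _   | fv-∀ y≢z q = fv-∀ y≢z (freshenBinders-∈FV A q)
  freshenBinders-∈FV {y = y} (∃ᵖ z A) p with z ≟ y | p
  ... | yes _  | fv-∃ _ q   =
    ⊥-elim (renameVar-∉FV (freshenBinders y A) (freshVar-≢ (freshenBinders y A)) q)
  ... | no _   | fv-∃ y≢z q = fv-∃ y≢z (freshenBinders-∈FV A q)

  module Derivations (def : Sym) where

    open Definedness def

    -- Natural deduction inside MG^c: in X ▷ A the hypotheses form the single conjunction X.

    infix  4 _▷_
    infixr 9 _⨾_

    _▷_ : Pattern Sym → Pattern Sym → Set
    A ▷ B = ⊢ (A ⇒ B)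

    _⨾_ : A ▷ B → B ▷ C → A ▷ C
    _⨾_ = r-syll

    ▷-refl : A ▷ A
    ▷-refl = ax-∧-dup _ ⨾ ax-∧-elim _ _

    ▷-const : ⊢ B → A ▷ B
    ▷-const b = r-mp b (r-exp (ax-∧-elim _ _))

    ∧-elimˡ : A ∧ᵖ B ▷ A
    ∧-elimˡ = ax-∧-elim _ _

    ∧-comm : A ∧ᵖ B ▷ B ∧ᵖ A
    ∧-comm = ax-∧-comm _ _

    ∧-elimʳ : A ∧ᵖ B ▷ B
    ∧-elimʳ = ∧-comm ⨾ ∧-elimˡ

    ⟨_,_⟩ : X ▷ A → X ▷ B → X ▷ A ∧ᵖ B
    ⟨ f , g ⟩ = ax-∧-dup _ ⨾ ∧-monoˡ f ⨾ ∧-comm ⨾ ∧-monoˡ g ⨾ ∧-comm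
      where
        ∧-monoˡ : ∀ {A B C} → A ▷ B → A ∧ᵖ C ▷ B ∧ᵖ C
        ∧-monoˡ f = r-imp (f ⨾ r-exp ▷-refl)

    weaken : X ▷ A → X ∧ᵖ Y ▷ A
    weaken f = ∧-elimˡ ⨾ f

    ⇒-intro : X ∧ᵖ A ▷ B → X ▷ (A ⇒ B)
    ⇒-intro = r-exp

    ⇒-elim : X ▷ (A ⇒ B) → X ▷ A → X ▷ B
    ⇒-elim f a = ⟨ ▷-refl , a ⟩ ⨾ r-imp f

    ∨-introˡ : A ▷ A ∨ᵖ B
    ∨-introˡ = ax-∨-intro _ _

    ∨-introʳ : B ▷ A ∨ᵖ B
    ∨-introʳ = ax-∨-intro _ _ ⨾ ax-∨-comm _ _

    ∨-rec : A ▷ C → B ▷ C → A ∨ᵖ B ▷ C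
    ∨-rec {A = A} {C = C} f g = r-∨-mono A g ⨾ ax-∨-comm A C ⨾ r-∨-mono C f ⨾ ax-∨-idem C

    ∨-elim : X ▷ A ∨ᵖ B → X ∧ᵖ A ▷ C → X ∧ᵖ B ▷ C → X ▷ C
    ∨-elim d f g = ⇒-elim (d ⨾ ∨-rec (⇒-intro (∧-comm ⨾ f)) (⇒-intro (∧-comm ⨾ g))) ▷-refl

    ¬-elim : X ▷ ¬ᵖ A → X ▷ A → X ▷ ⊥ᵖ
    ¬-elim n a = ⇒-elim (n ⨾ ax-¬-⇒ _) a

    ¬-intro : X ∧ᵖ A ▷ ⊥ᵖ → X ▷ ¬ᵖ A
    ¬-intro f = ⇒-intro f ⨾ ax-⇒-¬ _

    ⊥ᵖ-elim : X ▷ ⊥ᵖ → X ▷ C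
    ⊥ᵖ-elim f = f ⨾ ax-⊥ _

    ∧-split : A ▷ (A ∧ᵖ B) ∨ᵖ (A ∧ᵖ ¬ᵖ B)
    ∧-split = ∨-elim (▷-const (ax-lem _)) ∨-introˡ ∨-introʳ

    ¬¬-elim : ¬ᵖ ¬ᵖ A ▷ A
    ¬¬-elim = ∨-elim (▷-const (ax-lem _)) ∧-elimʳ (⊥ᵖ-elim (¬-elim ∧-elimˡ ∧-elimʳ))

    ¬¬-intro : A ▷ ¬ᵖ ¬ᵖ A
    ¬¬-intro = ¬-intro (¬-elim ∧-elimʳ ∧-elimˡ)

    contraposition : A ▷ B → ¬ᵖ B ▷ ¬ᵖ A
    contraposition f = ¬-intro (¬-elim ∧-elimˡ (∧-elimʳ ⨾ f))

    ¬-mono : X ▷ (A′ ⇒ A) → X ▷ (¬ᵖ A ⇒ ¬ᵖ A′)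
    ¬-mono f = ⇒-intro (¬-intro (¬-elim (weaken ∧-elimʳ) (⇒-elim (weaken (weaken f)) ∧-elimʳ)))

    ⇒-mono : X ▷ (A′ ⇒ A) → X ▷ (B ⇒ B′) → X ▷ ((A ⇒ B) ⇒ (A′ ⇒ B′))
    ⇒-mono f g = ⇒-intro (⇒-intro
      (⇒-elim (weaken (weaken g)) (⇒-elim (weaken ∧-elimʳ) (⇒-elim (weaken (weaken f)) ∧-elimʳ))))

    ∧-mono : X ▷ (A ⇒ A′) → X ▷ (B ⇒ B′) → X ▷ (A ∧ᵖ B ⇒ A′ ∧ᵖ B′)
    ∧-mono f g =
      ⇒-intro ⟨ ⇒-elim (weaken f) (∧-elimʳ ⨾ ∧-elimˡ) , ⇒-elim (weaken g) (∧-elimʳ ⨾ ∧-elimʳ) ⟩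

    ∨-mono : X ▷ (A ⇒ A′) → X ▷ (B ⇒ B′) → X ▷ (A ∨ᵖ B ⇒ A′ ∨ᵖ B′)
    ∨-mono f g = ⇒-intro (∨-elim ∧-elimʳ
      (⇒-elim (weaken (weaken f)) ∧-elimʳ ⨾ ∨-introˡ)
      (⇒-elim (weaken (weaken g)) ∧-elimʳ ⨾ ∨-introʳ))

    ⇔-elimˡ : X ▷ (A ⇔ B) → X ▷ (A ⇒ B)
    ⇔-elimˡ e = e ⨾ ∧-elimˡ

    ⇔-elimʳ : X ▷ (A ⇔ B) → X ▷ (B ⇒ A)
    ⇔-elimʳ e = e ⨾ ∧-elimʳ

    ⇔-refl : X ▷ (A ⇔ A)
    ⇔-refl = ⟨ ⇒-intro ∧-elimʳ , ⇒-intro ∧-elimʳ ⟩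

    ¬-cong : X ▷ (A ⇔ A′) → X ▷ ((¬ᵖ A) ⇔ (¬ᵖ A′))
    ¬-cong e = ⟨ ¬-mono (⇔-elimʳ e) , ¬-mono (⇔-elimˡ e) ⟩

    ⇒-cong : X ▷ (A ⇔ A′) → X ▷ (B ⇔ B′) → X ▷ ((A ⇒ B) ⇔ (A′ ⇒ B′))
    ⇒-cong e f = ⟨ ⇒-mono (⇔-elimʳ e) (⇔-elimˡ f) , ⇒-mono (⇔-elimˡ e) (⇔-elimʳ f) ⟩

    ∧-cong : X ▷ (A ⇔ A′) → X ▷ (B ⇔ B′) → X ▷ ((A ∧ᵖ B) ⇔ (A′ ∧ᵖ B′))
    ∧-cong e f = ⟨ ∧-mono (⇔-elimˡ e) (⇔-elimˡ f) , ∧-mono (⇔-elimʳ e) (⇔-elimʳ f) ⟩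

    ∨-cong : X ▷ (A ⇔ A′) → X ▷ (B ⇔ B′) → X ▷ ((A ∨ᵖ B) ⇔ (A′ ∨ᵖ B′))
    ∨-cong e f = ⟨ ∨-mono (⇔-elimˡ e) (⇔-elimˡ f) , ∨-mono (⇔-elimʳ e) (⇔-elimʳ f) ⟩

    ⊤ᵖ : Pattern Sym
    ⊤ᵖ = ⊥ᵖ ⇒ ⊥ᵖ

    closed : ⊤ᵖ ▷ A → ⊢ A
    closed = r-mp ▷-refl

    ⊢⇔-elimˡ : ⊢ (A ⇔ B) → A ▷ B
    ⊢⇔-elimˡ e = r-mp e ∧-elimˡ

    ⊢⇔-elimʳ : ⊢ (A ⇔ B) → B ▷ A
    ⊢⇔-elimʳ e = r-mp e ∧-elimʳ

    ⊢⇔-intro : A ▷ B → B ▷ A → ⊢ (A ⇔ B)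
    ⊢⇔-intro f g = closed ⟨ ▷-const f , ▷-const g ⟩

    ⊢⇔-trans : ⊢ (A ⇔ B) → ⊢ (B ⇔ C) → ⊢ (A ⇔ C)
    ⊢⇔-trans e f = ⊢⇔-intro (⊢⇔-elimˡ e ⨾ ⊢⇔-elimˡ f) (⊢⇔-elimʳ f ⨾ ⊢⇔-elimʳ e)

    ∀-mono : A ▷ B → ∀ᵖ x A ▷ ∀ᵖ x B
    ∀-mono {x = x} f = r-mp (r-gen x f) (ax-∀-dist _ _ _)

    ∃-mono : A ▷ B → ∃ᵖ x A ▷ ∃ᵖ x B
    ∃-mono f = ax-∃-∀ _ _ ⨾ contraposition (∀-mono (contraposition f)) ⨾ ax-∀-∃ _ _

    ∀-cong : ∀ᵖ x (A ⇔ B) ▷ (∀ᵖ x A ⇔ ∀ᵖ x B)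
    ∀-cong = ⟨ ∀-mono ∧-elimˡ ⨾ ax-∀-dist _ _ _ , ∀-mono ∧-elimʳ ⨾ ax-∀-dist _ _ _ ⟩

    ∃-⇒-dual : X ▷ (¬ᵖ ∀ᵖ x (¬ᵖ A) ⇒ ¬ᵖ ∀ᵖ y (¬ᵖ B)) → X ▷ (∃ᵖ x A ⇒ ∃ᵖ y B)
    ∃-⇒-dual = ⇒-elim (⇒-mono (▷-const (ax-∃-∀ _ _)) (▷-const (ax-∀-∃ _ _)))

    ∃-dual : X ▷ (∀ᵖ x (¬ᵖ A) ⇔ ∀ᵖ y (¬ᵖ B)) → X ▷ (∃ᵖ x A ⇔ ∃ᵖ y B)
    ∃-dual e = ⟨ ∃-⇒-dual (¬-mono (⇔-elimʳ e)) , ∃-⇒-dual (¬-mono (⇔-elimˡ e)) ⟩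

    ∃-cong : ∀ᵖ x (A ⇔ B) ▷ (∃ᵖ x A ⇔ ∃ᵖ x B)
    ∃-cong = ∃-dual (∀-mono (¬-cong ▷-refl) ⨾ ∀-cong)

    ∀-∃-mono : ∀ᵖ x (A ⇒ B) ▷ (∃ᵖ x A ⇒ ∃ᵖ x B)
    ∀-∃-mono = ∃-⇒-dual (¬-mono (∀-mono (¬-mono ▷-refl) ⨾ ax-∀-dist _ _ _))

    ∀-∧-∃ : ∀ᵖ x A ∧ᵖ ∃ᵖ x B ▷ ∃ᵖ x (A ∧ᵖ B)
    ∀-∧-∃ = ⇒-elim (weaken (∀-mono (⇒-intro ▷-refl) ⨾ ∀-∃-mono)) ∧-elimʳ

    ∀-vacuous : NotOccurs x A → A ▷ ∀ᵖ x A
    ∀-vacuous = ax-∀-vac _ _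

    ∃-vacuous : NotOccurs x A → ∃ᵖ x A ▷ A
    ∃-vacuous x∉A = ax-∃-∀ _ _ ⨾ contraposition (∀-vacuous (notOccurs-¬ x∉A)) ⨾ ¬¬-elim

    -- Predicate patterns and the replacement lemma

    Predicate : Pattern Sym → Set
    Predicate H = ⌈ ¬ᵖ H ⌉ ▷ ¬ᵖ H

    ⊤-predicate : Predicate ⊤ᵖ
    ⊤-predicate = ⊥ᵖ-elim (r-frameᵣ (sym def) (¬-elim ▷-refl (▷-const ▷-refl)) ⨾ ax-def-⊥)

    ⌊⌋-predicate : Predicate ⌊ A ⌋
    ⌊⌋-predicate = r-frameᵣ (sym def) ¬¬-elim ⨾ ax-def-·ᵣ _ _ ⨾ ¬¬-intro

    ∀-predicate : Predicate H → Predicate (∀ᵖ x H)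
    ∀-predicate pH = r-frameᵣ (sym def) (contraposition (∀-mono ¬¬-elim) ⨾ ax-∀-∃ _ _)
      ⨾ ax-prop-∃ᵣ _ _ _ ((λ ()) , (λ ())) ⨾ ∃-mono pH
      ⨾ ax-∃-∀ _ _ ⨾ contraposition (∀-mono ¬¬-intro)

    ∀*-predicate : ∀ xs → Predicate H → Predicate (∀* xs H)
    ∀*-predicate []       pH = pH
    ∀*-predicate (x ∷ xs) pH = ∀-predicate (∀*-predicate xs pH)

    -- Split A by H: the ¬H part passes through the application as ⌈¬H⌉, which H refutes.
    frameˡ : Predicate H → H ∧ᵖ A ▷ B → H ∧ᵖ (A · C) ▷ B · C
    frameˡ {H = H} {A = A} {B = B} {C = C} pH f =
      ∨-elim (∧-elimʳ ⨾ split) ∧-elimʳ (⊥ᵖ-elim (¬-elim ∧-elimʳ (∧-elimˡ ⨾ ∧-elimˡ)))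
      where
        split : A · C ▷ B · C ∨ᵖ ¬ᵖ H
        split = r-frameₗ C ∧-split ⨾ ax-prop-∨ₗ _ _ _ ⨾ ∨-rec (r-frameₗ C (∧-comm ⨾ f) ⨾ ∨-introˡ)
          (r-frameₗ C (∧-elimʳ ⨾ ax-def-in _) ⨾ ax-def-·ₗ _ _ ⨾ pH ⨾ ∨-introʳ)

    frameʳ : Predicate H → H ∧ᵖ A ▷ B → H ∧ᵖ (C · A) ▷ C · B
    frameʳ {H = H} {A = A} {B = B} {C = C} pH f =
      ∨-elim (∧-elimʳ ⨾ split) ∧-elimʳ (⊥ᵖ-elim (¬-elim ∧-elimʳ (∧-elimˡ ⨾ ∧-elimˡ)))
      where
        split : C · A ▷ C · B ∨ᵖ ¬ᵖ H
        split = r-frameᵣ C ∧-split ⨾ ax-prop-∨ᵣ _ _ _ ⨾ ∨-rec (r-frameᵣ C (∧-comm ⨾ f) ⨾ ∨-introˡ)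
          (r-frameᵣ C (∧-elimʳ ⨾ ax-def-in _) ⨾ ax-def-·ᵣ _ _ ⨾ pH ⨾ ∨-introʳ)

    ·-mono : Predicate H → H ▷ (A ⇒ A′) → H ▷ (B ⇒ B′) → H ▷ (A · B ⇒ A′ · B′)
    ·-mono pH f g = ⇒-intro
      (⟨ ∧-elimˡ , frameˡ pH (⇒-elim (weaken f) ∧-elimʳ) ⟩ ⨾ frameʳ pH (⇒-elim (weaken g) ∧-elimʳ))

    ·-cong : Predicate H → H ▷ (A ⇔ A′) → H ▷ (B ⇔ B′) → H ▷ ((A · B) ⇔ (A′ · B′))
    ·-cong pH e f = ⟨ ·-mono pH (⇔-elimˡ e) (⇔-elimˡ f) , ·-mono pH (⇔-elimʳ e) (⇔-elimʳ f) ⟩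

    replacement : ∀ {φ ψ χ θ b} → Predicate H → H ▷ (φ ⇔ ψ) → (∀ {z} → z ∈BV χ → H ▷ ∀ᵖ z H)
      → Replace φ ψ b χ θ → H ▷ (χ ⇔ θ)
    replacement {H = H} {φ = φ} {ψ = ψ} pH φ⇔ψ = go
      where
        go : ∀ {χ θ b} → (∀ {z} → z ∈BV χ → H ▷ ∀ᵖ z H) → Replace φ ψ b χ θ → H ▷ (χ ⇔ θ)
        go gen here      = φ⇔ψ
        go gen r-var     = ⇔-refl
        go gen r-sym     = ⇔-refl
        go gen r-⊥       = ⇔-refl
        go gen (r-¬ r)   = ¬-cong (go (gen ∘ bv-¬) r)
        go gen (r-⇒ r s) = ⇒-cong (go (gen ∘ bv-⇒ₗ) r) (go (gen ∘ bv-⇒ᵣ) s)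
        go gen (r-∧ r s) = ∧-cong (go (gen ∘ bv-∧ₗ) r) (go (gen ∘ bv-∧ᵣ) s)
        go gen (r-∨ r s) = ∨-cong (go (gen ∘ bv-∨ₗ) r) (go (gen ∘ bv-∨ᵣ) s)
        go gen (r-· r s) = ·-cong pH (go (gen ∘ bv-·ₗ) r) (go (gen ∘ bv-·ᵣ) s)
        go gen (r-∀ r)   = gen bv-∀ ⨾ ∀-mono (go (gen ∘ bv-∀ᵢ) r) ⨾ ∀-cong
        go gen (r-∃ r)   = gen bv-∃ ⨾ ∀-mono (go (gen ∘ bv-∃ᵢ) r) ⨾ ∃-cong

    -- Equality, instantiation and α-renaming

    ∈FV-=ᵖ : z ∈FV (A =ᵖ B) → z ∈FV A ⊎ z ∈FV B
    ∈FV-=ᵖ (fv-¬ (fv-·ₗ ()))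
    ∈FV-=ᵖ (fv-¬ (fv-·ᵣ (fv-¬ (fv-∧ₗ (fv-⇒ₗ p))))) = inj₁ p
    ∈FV-=ᵖ (fv-¬ (fv-·ᵣ (fv-¬ (fv-∧ₗ (fv-⇒ᵣ p))))) = inj₂ p
    ∈FV-=ᵖ (fv-¬ (fv-·ᵣ (fv-¬ (fv-∧ᵣ (fv-⇒ₗ p))))) = inj₂ p
    ∈FV-=ᵖ (fv-¬ (fv-·ᵣ (fv-¬ (fv-∧ᵣ (fv-⇒ᵣ p))))) = inj₁ p

    ∈BV-=ᵖ : z ∈BV (A =ᵖ B) → z ∈BV A ⊎ z ∈BV B
    ∈BV-=ᵖ (bv-¬ (bv-·ₗ ()))
    ∈BV-=ᵖ (bv-¬ (bv-·ᵣ (bv-¬ (bv-∧ₗ (bv-⇒ₗ p))))) = inj₁ p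
    ∈BV-=ᵖ (bv-¬ (bv-·ᵣ (bv-¬ (bv-∧ₗ (bv-⇒ᵣ p))))) = inj₂ p
    ∈BV-=ᵖ (bv-¬ (bv-·ᵣ (bv-¬ (bv-∧ᵣ (bv-⇒ₗ p))))) = inj₂ p
    ∈BV-=ᵖ (bv-¬ (bv-·ᵣ (bv-¬ (bv-∧ᵣ (bv-⇒ᵣ p))))) = inj₁ p

    notOccurs-=ᵖ : NotOccurs z A → NotOccurs z B → NotOccurs z (A =ᵖ B)
    notOccurs-=ᵖ (z∉FVA , z∉BVA) (z∉FVB , z∉BVB) =
      [ z∉FVA , z∉FVB ]′ ∘ ∈FV-=ᵖ , [ z∉BVA , z∉BVB ]′ ∘ ∈BV-=ᵖ

    ⌊⌋-elim : ⌊ A ⌋ ▷ A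
    ⌊⌋-elim = contraposition (ax-def-in _) ⨾ ¬¬-elim

    =ᵖ-sym : (A =ᵖ B) ▷ (B =ᵖ A)
    =ᵖ-sym = contraposition (r-frameᵣ (sym def) (contraposition ∧-comm))

    =ᵖ-renameVar : ¬ x ∈BV B → NotOccurs w B → (var x =ᵖ var w) ▷ (B ⇔ renameVar x w B)
    =ᵖ-renameVar {x = x} {B = B} {w = w} x∉BV (_ , w∉BV) =
      replacement ⌊⌋-predicate ⌊⌋-elim generalise (proj₂ (renameVar-replace x w B))
      where
        generalise : z ∈BV B → (var x =ᵖ var w) ▷ ∀ᵖ z (var x =ᵖ var w)
        generalise z∈BV = ∀-vacuous (notOccurs-=ᵖ (notOccurs-var λ { refl → x∉BV z∈BV })
                                                  (notOccurs-var λ { refl → w∉BV z∈BV }))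

    -- Some x equals w by the axiom ∃x (x = w); for that x, B gives C, which does not mention x.
    ∀-instantiate : x ≢ w → (var x =ᵖ var w) ▷ (B ⇒ C) → NotOccurs x C → ∀ᵖ x B ▷ C
    ∀-instantiate x≢w B⇒C x∉C = ⟨ ▷-refl , ▷-const (ax-exists _ _ x≢w) ⟩ ⨾ ∀-∧-∃
      ⨾ ∃-mono (⇒-elim (∧-elimʳ ⨾ B⇒C) ∧-elimˡ) ⨾ ∃-vacuous x∉C

    ∀-renameVar-elim : ¬ x ∈BV B → NotOccurs w B → x ≢ w → ∀ᵖ w (renameVar x w B) ▷ B
    ∀-renameVar-elim x∉BV w∉B x≢w =
      ∀-instantiate (≢-sym x≢w) (=ᵖ-sym ⨾ ⇔-elimʳ (=ᵖ-renameVar x∉BV w∉B)) w∉B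

    α-∀ : ¬ x ∈BV B → NotOccurs w B → x ≢ w → ⊢ (∀ᵖ x B ⇔ ∀ᵖ w (renameVar x w B))
    α-∀ {x = x} {B = B} {w = w} x∉BV w∉B x≢w = ⊢⇔-intro
      (∀-vacuous (notOccurs-∀ (≢-sym x≢w) w∉B)
        ⨾ ∀-mono (∀-instantiate x≢w (⇔-elimˡ (=ᵖ-renameVar x∉BV w∉B)) x∉renamed))
      (∀-vacuous (notOccurs-∀ x≢w x∉renamed) ⨾ ∀-mono (∀-renameVar-elim x∉BV w∉B x≢w))
      where
        x∉renamed : NotOccurs x (renameVar x w B)
        x∉renamed = renameVar-notOccurs x∉BV x≢w

    α-∃ : ¬ x ∈BV B → NotOccurs w B → x ≢ w → ⊢ (∃ᵖ x B ⇔ ∃ᵖ w (renameVar x w B))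
    α-∃ x∉BV w∉B x≢w =
      closed (∃-dual (▷-const (α-∀ (λ { (bv-¬ p) → x∉BV p }) (notOccurs-¬ w∉B) x≢w)))

    freshenBinders-⇔ : ∀ y A → ⊢ (A ⇔ freshenBinders y A)
    freshenBinders-⇔ y (var x)  = closed ⇔-refl
    freshenBinders-⇔ y (sym s)  = closed ⇔-refl
    freshenBinders-⇔ y ⊥ᵖ       = closed ⇔-refl
    freshenBinders-⇔ y (¬ᵖ A)   = closed (¬-cong (▷-const (freshenBinders-⇔ y A)))
    freshenBinders-⇔ y (A ⇒ B)  =
      closed (⇒-cong (▷-const (freshenBinders-⇔ y A)) (▷-const (freshenBinders-⇔ y B)))
    freshenBinders-⇔ y (A ∧ᵖ B) =
      closed (∧-cong (▷-const (freshenBinders-⇔ y A)) (▷-const (freshenBinders-⇔ y B)))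
    freshenBinders-⇔ y (A ∨ᵖ B) =
      closed (∨-cong (▷-const (freshenBinders-⇔ y A)) (▷-const (freshenBinders-⇔ y B)))
    freshenBinders-⇔ y (A · B)  =
      closed (·-cong ⊤-predicate (▷-const (freshenBinders-⇔ y A)) (▷-const (freshenBinders-⇔ y B)))
    freshenBinders-⇔ y (∀ᵖ z A) with z ≟ y
    ... | yes refl = ⊢⇔-trans (r-mp (r-gen y (freshenBinders-⇔ y A)) ∀-cong)
      (α-∀ (freshenBinders-∉BV A) freshVar-notOccurs (freshVar-≢ (freshenBinders y A)))
    ... | no _     = r-mp (r-gen z (freshenBinders-⇔ y A)) ∀-cong
    freshenBinders-⇔ y (∃ᵖ z A) with z ≟ y
    ... | yes refl = ⊢⇔-trans (r-mp (r-gen y (freshenBinders-⇔ y A)) ∃-cong)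
      (α-∃ (freshenBinders-∉BV A) freshVar-notOccurs (freshVar-≢ (freshenBinders y A)))
    ... | no _     = r-mp (r-gen z (freshenBinders-⇔ y A)) ∃-cong

    ∀-vacuous-∉FV : ¬ y ∈FV A → A ▷ ∀ᵖ y A
    ∀-vacuous-∉FV {y = y} {A = A} y∉FV = ⊢⇔-elimˡ A⇔A′
      ⨾ ∀-vacuous (y∉FV ∘ freshenBinders-∈FV A , freshenBinders-∉BV A) ⨾ ∀-mono (⊢⇔-elimʳ A⇔A′)
      where
        A⇔A′ : ⊢ (A ⇔ freshenBinders y A)
        A⇔A′ = freshenBinders-⇔ y A

    ∀-elim : ∀ᵖ x A ▷ A
    ∀-elim {x = x} {A = A} = ∀-mono (⊢⇔-elimˡ A⇔A′) ⨾ ⊢⇔-elimˡ (α-∀ x∉BV w∉A′ x≢w)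
      ⨾ ∀-renameVar-elim x∉BV w∉A′ x≢w ⨾ ⊢⇔-elimʳ A⇔A′
      where
        A⇔A′ : ⊢ (A ⇔ freshenBinders x A)
        A⇔A′ = freshenBinders-⇔ x A
        x∉BV : ¬ x ∈BV freshenBinders x A
        x∉BV = freshenBinders-∉BV A
        w∉A′ : NotOccurs (freshVar (freshenBinders x A) x) (freshenBinders x A)
        w∉A′ = freshVar-notOccurs
        x≢w : x ≢ freshVar (freshenBinders x A) x
        x≢w = freshVar-≢ (freshenBinders x A)

    ∀*-elim : ∀ xs → ∀* xs A ▷ A
    ∀*-elim []       = ▷-refl
    ∀*-elim (x ∷ xs) = ∀-elim ⨾ ∀*-elim xs

mainTheorem8 : {Sym : Set} (def : Sym) (φ ψ χ θ : Pattern Sym) (xs : List EVar)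
    → φ ⊑ χ
    → Replace φ ψ true χ θ
    → (∀ x → (x ∈FV φ ⊎ x ∈FV ψ) → x ∈BV χ → x ∈ xs)
    → Definedness.⊢_ def (∀* xs (Definedness._=ᵖ_ def φ ψ) ⇒ (χ ⇔ θ))
mainTheorem8 def φ ψ χ θ xs _ χ↝θ captured∈xs =
  replacement (∀*-predicate xs ⌊⌋-predicate) (∀*-elim xs ⨾ ⌊⌋-elim) generalise χ↝θ
  where
    open Definedness def
    open Derivations def
    generalise : ∀ {z} → z ∈BV χ → ∀* xs (φ =ᵖ ψ) ▷ ∀ᵖ z (∀* xs (φ =ᵖ ψ))
    generalise {z} z∈BV = ∀-vacuous-∉FV λ z∈FV →
      let (z∈FV-φ=ψ , z∉xs) = ∈FV-∀* xs z∈FV in z∉xs (captured∈xs z (∈FV-=ᵖ z∈FV-φ=ψ) z∈BV)
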